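{- A graph $G$ has exactly one minimum zero forcing set (i.e., $G$ is a unique zero forcing graph) if and only if $G$ has no edges.
   Context: In a graph $G$, zero forcing works as follows: a set of vertices is initially active; if an active vertex $u$ has exactly one non-active neighbor $v$, then $v$ becomes active. A set $S\subseteq V(G)$ is a zero forcing set if, starting with exactly the vertices of $S$ active and repeatedly applying this rule, all vertices become active. A minimum zero forcing set is one of minimum cardinality. -}

module Defs where

open import Data.Nat using (ℕ; _≤_)
open import Data.Bool using (Bool; true; false)
open import Data.Fin using (Fin)
open import Data.Fin.Subset using (Subset; _∈_; ∣_∣)
open import Data.Product using (Σ; _×_; ∃)
open import Relation.Binary.PropositionalEquality using (_≡_; _≢_)

record Graph (n : ℕ) : Set where
  field
    adj   : Fin n → Fin n → Bool
    sym   : ∀ u v → adj u v ≡ adj v u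
    irrefl : ∀ v → adj v v ≡ false

open Graph public

Adj : ∀ {n} → Graph n → Fin n → Fin n → Set
Adj G u v = adj G u v ≡ true

data Active {n : ℕ} (G : Graph n) (S : Subset n) : Fin n → Set where
  initial : ∀ {v} → v ∈ S → Active G S v
  force   : ∀ {v} (u : Fin n) → Active G S u → Adj G u v →
            (∀ w → Adj G u w → w ≢ v → Active G S w) →
            Active G S v

IsZeroForcingSet : ∀ {n} → Graph n → Subset n → Set
IsZeroForcingSet G S = ∀ v → Active G S v

IsMinimumZeroForcingSet : ∀ {n} → Graph n → Subset n → Set
IsMinimumZeroForcingSet G S =
  IsZeroForcingSet G S × (∀ T → IsZeroForcingSet G T → ∣ S ∣ ≤ ∣ T ∣)

IsUniqueZeroForcingGraph : ∀ {n} → Graph n → Set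
IsUniqueZeroForcingGraph {n} G =
  Σ (Subset n) λ S → IsMinimumZeroForcingSet G S ×
    (∀ T → IsMinimumZeroForcingSet G T → T ≡ S)

HasNoEdges : ∀ {n} → Graph n → Set
HasNoEdges G = ∀ u v → adj G u v ≡ false

-- Record a zero forcing process from a minimum zero forcing set S as a chronological
-- list of forces u → v, and let F be its set of forcers.  Every vertex forces at most
-- once, so |F| = n − |S|; and running the forces backwards (v forces u) shows that the
-- complement of F, the set of terminal vertices, is again a zero forcing set, hence a
-- minimum one.  If G has an edge u v then ⊤ − v is a zero forcing set, so S ≠ ⊤ and the
-- first forcer lies in S but not in the complement of F: the two minimum sets differ.
-- Conversely, without edges nothing is ever forced, so ⊤ is the only zero forcing set.
module Submission where

open import Defs hiding (sym)
open import Data.Nat using (ℕ; zero; suc; _+_; _∸_; _≤_)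
open import Data.Nat.Properties using (+-suc; +-identityʳ; m+1+n≢m; m+n∸n≡m; m+[n∸m]≡n; <⇒≱; ≤-reflexive)
open import Data.Bool using (true; false)
open import Data.Bool.Properties using () renaming (_≟_ to _≟ᴮ_)
open import Data.Fin using (Fin; zero; suc; _≟_)
open import Data.Fin.Properties using (any?; all?; ¬∀⟶∃¬)
open import Data.Fin.Subset
open import Data.Fin.Subset.Properties
open import Data.Vec using (_∷_; here; there)
open import Data.Product using (_×_; _,_; proj₁; proj₂; ∃; ∃₂)
open import Data.Sum using (_⊎_; inj₁; inj₂; [_,_]′)
open import Data.Empty using (⊥-elim)
open import Function using (_∘_)
open import Relation.Nullary using (Dec; yes; no; contradiction)
open import Relation.Nullary.Decidable using (_×-dec_; ¬?)
open import Relation.Binary.PropositionalEquality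
  using (_≡_; _≢_; refl; sym; trans; cong; cong₂; subst; module ≡-Reasoning)

x∈p∪⁅y⁆⁻ : ∀ {n} {x y : Fin n} (p : Subset n) → x ∈ p ∪ ⁅ y ⁆ → x ∈ p ⊎ x ≡ y
x∈p∪⁅y⁆⁻ {y = y} p x∈ with x∈p∪q⁻ p ⁅ y ⁆ x∈
... | inj₁ x∈p = inj₁ x∈p
... | inj₂ x∈⁅y⁆ = inj₂ (x∈⁅y⁆⇒x≡y y x∈⁅y⁆)

x∉p⇒∣p∪⁅x⁆∣≡1+∣p∣ : ∀ {n} (p : Subset n) (x : Fin n) → x ∉ p → ∣ p ∪ ⁅ x ⁆ ∣ ≡ suc ∣ p ∣
x∉p⇒∣p∪⁅x⁆∣≡1+∣p∣ (outside ∷ p) zero    x∉p = cong (suc ∘ ∣_∣) (∪-identityʳ p)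
x∉p⇒∣p∪⁅x⁆∣≡1+∣p∣ (inside  ∷ p) zero    x∉p = contradiction here x∉p
x∉p⇒∣p∪⁅x⁆∣≡1+∣p∣ (outside ∷ p) (suc x) x∉p = x∉p⇒∣p∪⁅x⁆∣≡1+∣p∣ p x (x∉p ∘ there)
x∉p⇒∣p∪⁅x⁆∣≡1+∣p∣ (inside  ∷ p) (suc x) x∉p = cong suc (x∉p⇒∣p∪⁅x⁆∣≡1+∣p∣ p x (x∉p ∘ there))

p≢⊤⇒∃∉p : ∀ {n} (p : Subset n) → p ≢ ⊤ → ∃ λ x → x ∉ p
p≢⊤⇒∃∉p {n} p p≢⊤ with all? (_∈? p)
... | yes ∀∈p = contradiction (⊆-antisym ⊆⊤ (λ {x} _ → ∀∈p x)) p≢⊤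
... | no ¬∀∈p = ¬∀⟶∃¬ n _ (_∈? p) ¬∀∈p

module _ {n : ℕ} (G : Graph n) where

  Adj-sym : ∀ {u v} → Adj G u v → Adj G v u
  Adj-sym {u} {v} uv = trans (Graph.sym G v u) uv

  Adj? : ∀ u v → Dec (Adj G u v)
  Adj? u v = adj G u v ≟ᴮ true

  Forces : Subset n → Fin n → Fin n → Set
  Forces A u v = u ∈ A × v ∉ A × Adj G u v × (∀ w → Adj G u w → w ≢ v → w ∈ A)

  infix 4 N[_]⊆_
  N[_]⊆_ : Fin n → Subset n → Set
  N[ x ]⊆ A = x ∈ A × (∀ w → Adj G x w → w ∈ A)

  data Chronology : Subset n → Subset n → Set where
    done : Chronology ⊤ ⊥
    step : ∀ {A F u v} → Forces A u v → Chronology (A ∪ ⁅ v ⁆) F → Chronology A (F ∪ ⁅ u ⁆)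

  -- Trace the derivation of x back to the first force that leaves A.
  activeOutside⇒force : ∀ {S A x} → S ⊆ A → Active G S x → x ∉ A → ∃₂ (Forces A)
  activeOutside⇒force S⊆A (initial x∈S) x∉A = contradiction (S⊆A x∈S) x∉A
  activeOutside⇒force {A = A} {x} S⊆A (force u u-active ux others) x∉A with u ∈? A
  ... | no u∉A = activeOutside⇒force S⊆A u-active u∉A
  ... | yes u∈A with any? (λ w → Adj? u w ×-dec ¬? (w ≟ x) ×-dec ¬? (w ∈? A))
  ...   | yes (w , uw , w≢x , w∉A) = activeOutside⇒force S⊆A (others w uw w≢x) w∉A
  ...   | no ¬escape = u , x , u∈A , x∉A , ux , rest
    where
    rest : ∀ w → Adj G u w → w ≢ x → w ∈ A
    rest w uw w≢x with w ∈? A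
    ... | yes w∈A = w∈A
    ... | no w∉A = contradiction (w , uw , w≢x , w∉A) ¬escape

  chronologyFrom : ∀ {S} → IsZeroForcingSet G S →
                   ∀ m {A} → S ⊆ A → ∣ A ∣ + m ≡ n → ∃ (Chronology A)
  chronologyFrom Z zero {A} S⊆A size =
    ⊥ , subst (λ B → Chronology B ⊥) (sym (∣p∣≡n⇒p≡⊤ (trans (sym (+-identityʳ ∣ A ∣)) size))) done
  chronologyFrom Z (suc m) {A} S⊆A size =
    let x , x∉A = p≢⊤⇒∃∉p A A≢⊤
        u , v , u→v = activeOutside⇒force S⊆A (Z x) x∉A
        F , C = chronologyFrom Z m (p⊆p∪q ⁅ v ⁆ ∘ S⊆A) (size′ u→v)
    in F ∪ ⁅ u ⁆ , step u→v C
    where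
    A≢⊤ : A ≢ ⊤
    A≢⊤ refl = m+1+n≢m n (trans (cong (_+ suc m) (sym (∣⊤∣≡n n))) size)
    size′ : ∀ {u v} → Forces A u v → ∣ A ∪ ⁅ v ⁆ ∣ + m ≡ n
    size′ {v = v} (_ , v∉A , _) =
      trans (cong (_+ m) (x∉p⇒∣p∪⁅x⁆∣≡1+∣p∣ A v v∉A)) (trans (sym (+-suc ∣ A ∣ m)) size)

  chronology : ∀ {S} → IsZeroForcingSet G S → ∃ (Chronology S)
  chronology {S} Z = chronologyFrom Z (n ∸ ∣ S ∣) (λ x∈S → x∈S) (m+[n∸m]≡n (∣p∣≤n S))

  N⊆-∪ : ∀ {x A} y → N[ x ]⊆ A → N[ x ]⊆ A ∪ ⁅ y ⁆
  N⊆-∪ y (x∈A , N⊆A) = p⊆p∪q ⁅ y ⁆ x∈A , λ w xw → p⊆p∪q ⁅ y ⁆ (N⊆A w xw)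

  forcer-N⊆ : ∀ {A u v} → Forces A u v → N[ u ]⊆ A ∪ ⁅ v ⁆
  forcer-N⊆ {A} {u} {v} (u∈A , _ , _ , others) = p⊆p∪q ⁅ v ⁆ u∈A , N⊆
    where
    N⊆ : ∀ w → Adj G u w → w ∈ A ∪ ⁅ v ⁆
    N⊆ w uw with w ≟ v
    ... | yes refl = q⊆p∪q A ⁅ v ⁆ (x∈⁅x⁆ v)
    ... | no w≢v = p⊆p∪q ⁅ v ⁆ (others w uw w≢v)

  N⊆⇒∉forcers : ∀ {A F x} → Chronology A F → N[ x ]⊆ A → x ∉ F
  N⊆⇒∉forcers done _ = ∉⊥
  N⊆⇒∉forcers {x = x} (step {F = F} {u} {v} (_ , v∉A , uv , _) C) N⊆A x∈F∪u
    with x∈p∪⁅y⁆⁻ F x∈F∪u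
  ... | inj₁ x∈F = N⊆⇒∉forcers C (N⊆-∪ v N⊆A) x∈F
  ... | inj₂ refl = v∉A (proj₂ N⊆A v uv)

  ∣A∣+∣F∣≡n : ∀ {A F} → Chronology A F → ∣ A ∣ + ∣ F ∣ ≡ n
  ∣A∣+∣F∣≡n done = trans (cong₂ _+_ (∣⊤∣≡n n) (∣⊥∣≡0 n)) (+-identityʳ n)
  ∣A∣+∣F∣≡n (step {A} {F} {u} {v} u→v@(_ , v∉A , _) C) = begin
    ∣ A ∣ + ∣ F ∪ ⁅ u ⁆ ∣     ≡⟨ cong (∣ A ∣ +_) (x∉p⇒∣p∪⁅x⁆∣≡1+∣p∣ F u u∉F) ⟩
    ∣ A ∣ + suc ∣ F ∣         ≡⟨ +-suc ∣ A ∣ ∣ F ∣ ⟩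
    suc ∣ A ∣ + ∣ F ∣         ≡⟨ cong (_+ ∣ F ∣) (x∉p⇒∣p∪⁅x⁆∣≡1+∣p∣ A v v∉A) ⟨
    ∣ A ∪ ⁅ v ⁆ ∣ + ∣ F ∣     ≡⟨ ∣A∣+∣F∣≡n C ⟩
    n                         ∎
    where
    open ≡-Reasoning
    u∉F : u ∉ F
    u∉F = N⊆⇒∉forcers C (forcer-N⊆ u→v)

  -- Running the chronology backwards: if u forced v, then v forces u.
  reverse : ∀ {A F T} → Chronology A F → (∀ x → x ∈ T ⊎ x ∈ F ⊎ N[ x ]⊆ A) →
            ∀ {x} → x ∈ F → Active G T x
  reverse done _ = ⊥-elim ∘ ∉⊥
  reverse {A} {T = T} (step {F = F} {u} {v} u→v@(u∈A , v∉A , uv , _) C) cover =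
    [ activeLater , (λ { refl → uActive }) ]′ ∘ x∈p∪⁅y⁆⁻ F
    where
    cover′ : ∀ y → y ∈ T ⊎ y ∈ F ⊎ N[ y ]⊆ A ∪ ⁅ v ⁆
    cover′ y with cover y
    ... | inj₁ y∈T = inj₁ y∈T
    ... | inj₂ (inj₂ N⊆A) = inj₂ (inj₂ (N⊆-∪ v N⊆A))
    ... | inj₂ (inj₁ y∈F∪u) with x∈p∪⁅y⁆⁻ F y∈F∪u
    ...   | inj₁ y∈F = inj₂ (inj₁ y∈F)
    ...   | inj₂ refl = inj₂ (inj₂ (forcer-N⊆ u→v))

    activeLater : ∀ {x} → x ∈ F → Active G T x
    activeLater = reverse C cover′

    activeOrN⊆ : ∀ y → y ≢ u → Active G T y ⊎ N[ y ]⊆ A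
    activeOrN⊆ y y≢u with cover y
    ... | inj₁ y∈T = inj₁ (initial y∈T)
    ... | inj₂ (inj₂ N⊆A) = inj₂ N⊆A
    ... | inj₂ (inj₁ y∈F∪u) with x∈p∪⁅y⁆⁻ F y∈F∪u
    ...   | inj₁ y∈F = inj₁ (activeLater y∈F)
    ...   | inj₂ y≡u = contradiction y≡u y≢u

    vActive : Active G T v
    vActive with activeOrN⊆ v (λ { refl → v∉A u∈A })
    ... | inj₁ active = active
    ... | inj₂ (v∈A , _) = contradiction v∈A v∉A

    othersActive : ∀ w → Adj G v w → w ≢ u → Active G T w
    othersActive w vw w≢u with activeOrN⊆ w w≢u
    ... | inj₁ active = active
    ... | inj₂ (_ , N⊆A) = contradiction (N⊆A v (Adj-sym vw)) v∉A

    uActive : Active G T u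
    uActive = force v vActive (Adj-sym uv) othersActive

  ∁forcers-isZFS : ∀ {S F} → Chronology S F → IsZeroForcingSet G (∁ F)
  ∁forcers-isZFS {F = F} C x with x ∈? F
  ... | yes x∈F = reverse C cover x∈F
    where
    cover : ∀ y → y ∈ ∁ F ⊎ y ∈ F ⊎ N[ y ]⊆ _
    cover y with y ∈? F
    ... | yes y∈F = inj₂ (inj₁ y∈F)
    ... | no y∉F = inj₁ (x∉p⇒x∈∁p y∉F)
  ... | no x∉F = initial (x∉p⇒x∈∁p x∉F)

  first-forcer : ∀ {A F} → Chronology A F → A ≢ ⊤ → ∃ λ u → u ∈ A × u ∈ F
  first-forcer done ⊤≢⊤ = contradiction refl ⊤≢⊤
  first-forcer (step {F = F} {u} (u∈A , _) _) _ = u , u∈A , q⊆p∪q F ⁅ u ⁆ (x∈⁅x⁆ u)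

  ∁forcers-isMinimum : ∀ {S F} → IsMinimumZeroForcingSet G S → Chronology S F →
                       IsMinimumZeroForcingSet G (∁ F)
  ∁forcers-isMinimum {S} {F} (_ , S-min) C =
    ∁forcers-isZFS C , λ R R-zfs → subst (_≤ ∣ R ∣) (sym ∣∁F∣≡∣S∣) (S-min R R-zfs)
    where
    open ≡-Reasoning
    ∣∁F∣≡∣S∣ : ∣ ∁ F ∣ ≡ ∣ S ∣
    ∣∁F∣≡∣S∣ = begin
      ∣ ∁ F ∣                   ≡⟨ ∣∁p∣≡n∸∣p∣ F ⟩
      n ∸ ∣ F ∣                 ≡⟨ cong (_∸ ∣ F ∣) (∣A∣+∣F∣≡n C) ⟨
      ∣ S ∣ + ∣ F ∣ ∸ ∣ F ∣     ≡⟨ m+n∸n≡m ∣ S ∣ ∣ F ∣ ⟩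
      ∣ S ∣                     ∎

  edge⇒⊤-v-isZFS : ∀ {u v} → Adj G u v → IsZeroForcingSet G (⊤ - v)
  edge⇒⊤-v-isZFS {u} {v} uv x with x ≟ v
  ... | no x≢v = initial (x∈p∧x≢y⇒x∈p-y ∈⊤ x≢v)
  ... | yes refl = force u (initial (x∈p∧x≢y⇒x∈p-y ∈⊤ u≢v)) uv
                     (λ w _ w≢v → initial (x∈p∧x≢y⇒x∈p-y ∈⊤ w≢v))
    where
    u≢v : u ≢ v
    u≢v refl with () ← trans (sym uv) (irrefl G u)

  edge⇒minimum≢⊤ : ∀ {S u v} → Adj G u v → IsMinimumZeroForcingSet G S → S ≢ ⊤
  edge⇒minimum≢⊤ {v = v} uv (_ , S-min) refl =
    <⇒≱ (x∈p⇒∣p-x∣<∣p∣ (∈⊤ {x = v})) (S-min (⊤ - v) (edge⇒⊤-v-isZFS uv))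

  noEdges⇒active⊆ : HasNoEdges G → ∀ {T x} → Active G T x → x ∈ T
  noEdges⇒active⊆ _ (initial x∈T) = x∈T
  noEdges⇒active⊆ no-edges (force u _ ux _) with () ← trans (sym ux) (no-edges u _)

  noEdges⇒zfs≡⊤ : HasNoEdges G → ∀ {T} → IsZeroForcingSet G T → T ≡ ⊤
  noEdges⇒zfs≡⊤ no-edges T-zfs = ⊆-antisym ⊆⊤ (λ {x} _ → noEdges⇒active⊆ no-edges (T-zfs x))

  uniqueZFG⇒noEdges : IsUniqueZeroForcingGraph G → HasNoEdges G
  uniqueZFG⇒noEdges (S , S-min , unique) u v with adj G u v in uv
  ... | false = refl
  ... | true =
    let F , C = chronology (proj₁ S-min)
        w , w∈S , w∈F = first-forcer C (edge⇒minimum≢⊤ uv S-min)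
        ∁F≡S = unique (∁ F) (∁forcers-isMinimum S-min C)
    in contradiction (subst (w ∈_) (sym ∁F≡S) w∈S) (x∈p⇒x∉∁p w∈F)

  noEdges⇒uniqueZFG : HasNoEdges G → IsUniqueZeroForcingGraph G
  noEdges⇒uniqueZFG no-edges = ⊤ , ⊤-min , λ T T-min → noEdges⇒zfs≡⊤ no-edges (proj₁ T-min)
    where
    ⊤-min : IsMinimumZeroForcingSet G ⊤
    ⊤-min = (λ _ → initial ∈⊤) ,
            λ T T-zfs → ≤-reflexive (cong ∣_∣ (sym (noEdges⇒zfs≡⊤ no-edges T-zfs)))

corollary3p3 : (n : ℕ) (G : Graph n) →
    (IsUniqueZeroForcingGraph G → HasNoEdges G) × (HasNoEdges G → IsUniqueZeroForcingGraph G)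
corollary3p3 n G = uniqueZFG⇒noEdges G , noEdges⇒uniqueZFG G
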